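{- Let $(\mathcal S,\chi)$ be a minimal MR geometry. Then each green point $G$ lies on a line containing exactly one green point and $b$ red points for some $b\ge 2$; hence $\deg(G)\le r(\mathcal S)-1$. Consequently each line contains at most $r(\mathcal S)-1$ points. Analogously, each red point lies on a line containing exactly one red point and at least two green points, has degree at most $g(\mathcal S)-1$, and consequently each line contains at most $g(\mathcal S)-1$ points.
   Context: A finite linear space (f.l.s.) consists of a finite set of points and a set of lines (sets of points) such that any two distinct points lie on exactly one common line, every line has at least two points, and not all points are on one line. For a set $T$ of points not all on one line, the subspace induced by $T$ has point set $T$ and lines the sets $\ell\cap T$ with $|\ell\cap T|\ge 2$. An MR geometry $(\mathcal S,\chi)$ is an f.l.s. $\mathcal S$ with a colouring $\chi$ of the points red/green such that every line contains a point of each colour. It is minimal if there is no point $P$ such that $\mathcal S\setminus\{P\}$ is not collinear and the subspace induced by $\mathcal S\setminus\{P\}$ with the restricted colouring is an MR geometry. $\deg(P)$ is the number of lines through $P$; $g(\mathcal S)$, $r(\mathcal S)$ are the numbers of green and red points. -}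

module Defs where

open import Data.Nat using (ℕ; zero; suc; _+_; _≤_; _∸_)
open import Data.Fin using (Fin; zero; suc; _≟_)
open import Data.Bool using (Bool; true; false; if_then_else_; _∧_; not)
open import Data.Product using (Σ; _×_; ∃; ∃-syntax)
open import Relation.Binary.PropositionalEquality using (_≡_; _≢_)
open import Relation.Nullary using (¬_)
open import Relation.Nullary.Decidable using (⌊_⌋)

count : ∀ {n} → (Fin n → Bool) → ℕ
count {zero}  f = 0
count {suc n} f = (if f zero then 1 else 0) + count (λ i → f (suc i))

record LinearSpace (n m : ℕ) : Set where
  field
    inc : Fin n → Fin m → Bool
    uniqueLine : ∀ (p q : Fin n) → p ≢ q →
      Σ (Fin m) λ l → inc p l ≡ true × inc q l ≡ true ×
        (∀ l′ → inc p l′ ≡ true → inc q l′ ≡ true → l′ ≡ l)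
    lineSize : ∀ (l : Fin m) → 2 ≤ count (λ p → inc p l)
    notAllOnOneLine : ∀ (l : Fin m) → ∃[ p ] inc p l ≡ false

open LinearSpace public

data Colour : Set where
  red green : Colour

isRed isGreen : Colour → Bool
isRed red = true
isRed green = false
isGreen red = false
isGreen green = true

module _ {n m : ℕ} (S : LinearSpace n m) (χ : Fin n → Colour) where

  deg : Fin n → ℕ
  deg P = count (λ l → inc S P l)

  lineCard : Fin m → ℕ
  lineCard l = count (λ p → inc S p l)

  g r : ℕ
  g = count (λ p → isGreen (χ p))
  r = count (λ p → isRed (χ p))

  greensOn redsOn : Fin m → ℕ
  greensOn l = count (λ p → inc S p l ∧ isGreen (χ p))
  redsOn l = count (λ p → inc S p l ∧ isRed (χ p))

  IsMR : Set
  IsMR = ∀ (l : Fin m) →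
    (∃[ p ] inc S p l ≡ true × χ p ≡ red) × (∃[ p ] inc S p l ≡ true × χ p ≡ green)

  Collinear : (Fin n → Bool) → Set
  Collinear T = ∃[ l ] (∀ p → T p ≡ true → inc S p l ≡ true)

  -- T not collinear, and the subspace induced by T (lines ℓ ∩ T with
  -- |ℓ ∩ T| ≥ 2) with the restricted colouring is an MR geometry
  InducedIsMR : (Fin n → Bool) → Set
  InducedIsMR T = ¬ Collinear T ×
    (∀ (l : Fin m) → 2 ≤ count (λ p → inc S p l ∧ T p) →
      (∃[ p ] inc S p l ∧ T p ≡ true × χ p ≡ red) ×
      (∃[ p ] inc S p l ∧ T p ≡ true × χ p ≡ green))

  minus : Fin n → (Fin n → Bool)
  minus P p = not ⌊ p ≟ P ⌋

  IsMinimalMR : Set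
  IsMinimalMR = IsMR × (∀ (P : Fin n) → ¬ InducedIsMR (minus P))

{-# OPTIONS --safe #-}
module Submission where

-- If P is a point of a minimal MR geometry, S ∖ {P} is still not collinear, so some line l
-- keeps at least two points after removing P but none of P's colour: l passes through P and
-- all its other points have the opposite colour. Picking on each line through P a point of
-- the opposite colour, with a spare choice on l, bounds deg P by that colour's count minus 1.
-- A line l has at most deg Q points for any Q off l; taking Q of colour opposite to c gives
-- |l| ≤ #c - 1. If there is no such Q, l contains all points of that colour and one more,
-- while a point off l (of colour c) bounds |l| by their number minus 1.

open import Defs
open import Data.Nat using (ℕ; suc; _+_; _≤_; _<_; _∸_; _≤?_; z≤n; s≤s; s≤s⁻¹)
open import Data.Nat.Properties using (≤-trans; +-suc; m∸n≤m; <-irrefl; module ≤-Reasoning)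
open import Data.Fin using (Fin; zero; suc; _≟_)
open import Data.Fin.Properties using (any?; suc-injective; 0≢1+n)
open import Data.Bool using (Bool; true; false; _∧_; if_then_else_)
import Data.Bool as Bool
open import Data.Bool.Properties using (not-¬; ¬-not)
open import Data.Product using (_×_; _,_; proj₁; proj₂; ∃; ∃₂; ∃-syntax)
open import Data.Sum using (_⊎_; inj₁; inj₂)
open import Function using (_∘_)
open import Relation.Nullary using (¬_; Dec; does; yes; no; contradiction)
open import Relation.Nullary.Decidable using (dec-false; _×-dec_; ¬?; decidable-stable)
open import Relation.Binary.Definitions using (DecidableEquality)
open import Relation.Binary.PropositionalEquality using (_≡_; _≢_; refl; sym; trans; cong; subst; ≢-sym)

∧-split : ∀ {a b : Bool} → a ∧ b ≡ true → a ≡ true × b ≡ true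
∧-split {true} {true} refl = refl , refl

∧-intro : ∀ {a b : Bool} → a ≡ true → b ≡ true → a ∧ b ≡ true
∧-intro refl refl = refl

count-none : ∀ {n} {f : Fin n → Bool} → (∀ i → f i ≡ false) → count f ≡ 0
count-none {0} none = refl
count-none {suc n} {f} none rewrite none zero = count-none (none ∘ suc)

-- Uses does rather than ⌊_⌋ (isYes, which is stuck on suc i ≟ suc k), so that
-- remove f (suc k) ∘ suc reduces to remove (f ∘ suc) k.
remove : ∀ {n} → (Fin n → Bool) → Fin n → Fin n → Bool
remove f k i = if does (i ≟ k) then false else f i

remove-intro : ∀ {n} (f : Fin n → Bool) {k i} → f i ≡ true → i ≢ k → remove f k i ≡ true
remove-intro f {k} {i} fi i≢k rewrite dec-false (i ≟ k) i≢k = fi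

remove-elim : ∀ {n} {f : Fin n → Bool} {k i} → remove f k i ≡ true → f i ≡ true × i ≢ k
remove-elim {k = k} {i} r with i ≟ k
... | no i≢k = r , i≢k

count-remove : ∀ {n} (f : Fin n → Bool) {k} → f k ≡ true → count f ≡ suc (count (remove f k))
count-remove {suc n} f {zero} fk rewrite fk = refl
count-remove {suc n} f {suc k} fk =
  trans (cong (b +_) (count-remove (f ∘ suc) fk)) (+-suc b _)
  where
  b = if f zero then 1 else 0

count-∃ : ∀ {n} (f : Fin n → Bool) → 1 ≤ count f → ∃ λ i → f i ≡ true
count-∃ {suc n} f c with f zero in f0
... | true = zero , f0
... | false = let (i , fi) = count-∃ (f ∘ suc) c in suc i , fi

count-∃₂ : ∀ {n} {f : Fin n → Bool} → 2 ≤ count f →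
  ∃₂ λ i j → i ≢ j × f i ≡ true × f j ≡ true
count-∃₂ {f = f} c =
  let (i , fi) = count-∃ f (≤-trans (s≤s z≤n) c)
      (j , rj) = count-∃ (remove f i) (s≤s⁻¹ (subst (2 ≤_) (count-remove f fi) c))
      (fj , j≢i) = remove-elim {f = f} rj
  in i , j , ≢-sym j≢i , fi , fj

count-≤-injection : ∀ {a b} {f : Fin a → Bool} {h : Fin b → Bool}
  (φ : ∀ i → f i ≡ true → Fin b) →
  (∀ i fi → h (φ i fi) ≡ true) →
  (∀ i j fi fj → φ i fi ≡ φ j fj → i ≡ j) →
  count f ≤ count h
count-≤-injection {0} φ into inj = z≤n
count-≤-injection {suc a} {f = f} {h} φ into inj with f zero in f0
... | false = count-≤-injection {f = f ∘ suc} {h = h} (φ ∘ suc) (into ∘ suc)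
                (λ i j fi fj e → suc-injective (inj (suc i) (suc j) fi fj e))
... | true rewrite count-remove h (into zero f0) =
  s≤s (count-≤-injection {f = f ∘ suc} {h = remove h (φ zero f0)} (φ ∘ suc)
        (λ i fi → remove-intro h (into (suc i) fi) (0≢1+n ∘ inj zero (suc i) f0 fi ∘ sym))
        (λ i j fi fj e → suc-injective (inj (suc i) (suc j) fi fj e)))

count-mono : ∀ {n} (f h : Fin n → Bool) → (∀ {i} → f i ≡ true → h i ≡ true) → count f ≤ count h
count-mono f h f⊆h =
  count-≤-injection {f = f} {h = h} (λ i _ → i) (λ _ → f⊆h) (λ _ _ _ _ e → e)

count≡1 : ∀ {n} (f : Fin n → Bool) {i} → f i ≡ true → (∀ {j} → f j ≡ true → j ≡ i) →
  count f ≡ 1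
count≡1 f {i} fi unique = trans (count-remove f fi) (cong suc (count-none removed))
  where
  removed : ∀ j → remove f i j ≡ false
  removed j with j ≟ i | f j in fj
  ... | yes _   | _     = refl
  ... | no j≢i  | true  = contradiction (unique fj) j≢i
  ... | no _    | false = refl

opposite : Colour → Colour
opposite red   = green
opposite green = red

isColour : Colour → Colour → Bool
isColour red   = isRed
isColour green = isGreen

_≟ᶜ_ : DecidableEquality Colour
red   ≟ᶜ red   = yes refl
red   ≟ᶜ green = no λ ()
green ≟ᶜ red   = no λ ()
green ≟ᶜ green = yes refl

colour-dichotomy : ∀ c d → d ≡ c ⊎ d ≡ opposite c
colour-dichotomy red   red   = inj₁ refl
colour-dichotomy red   green = inj₂ refl
colour-dichotomy green red   = inj₂ refl
colour-dichotomy green green = inj₁ refl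

opposite-involutive : ∀ c → opposite (opposite c) ≡ c
opposite-involutive red   = refl
opposite-involutive green = refl

opposite-≢ : ∀ {c} → opposite c ≢ c
opposite-≢ {red}   ()
opposite-≢ {green} ()

opposite-of-≢ : ∀ {c d} → d ≢ c → opposite d ≡ c
opposite-of-≢ {c} {d} d≢c with colour-dichotomy c d
... | inj₁ d≡c  = contradiction d≡c d≢c
... | inj₂ refl = opposite-involutive c

isColour-intro : ∀ {c d} → d ≡ c → isColour c d ≡ true
isColour-intro {red}   refl = refl
isColour-intro {green} refl = refl

isColour-elim : ∀ {c d} → isColour c d ≡ true → d ≡ c
isColour-elim {red}   {red}   _ = refl
isColour-elim {green} {green} _ = refl

module Geometry {n m : ℕ} (S : LinearSpace n m) (χ : Fin n → Colour) where

  _∈_ : Fin n → Fin m → Set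
  p ∈ l = inc S p l ≡ true

  lineMinus : Fin m → Fin n → Fin n → Bool
  lineMinus l P p = inc S p l ∧ minus S χ P p

  hasColour : Colour → Fin n → Bool
  hasColour c p = isColour c (χ p)

  colourOn : Colour → Fin m → Fin n → Bool
  colourOn c l p = inc S p l ∧ hasColour c p

  colourCount : Colour → ℕ
  colourCount c = count (hasColour c)

  colourCountOn : Colour → Fin m → ℕ
  colourCountOn c l = count (colourOn c l)

  DegreeBound : Set
  DegreeBound = ∀ P → deg S χ P ≤ colourCount (opposite (χ P)) ∸ 1

  NoRemovablePoint : Set
  NoRemovablePoint = ∀ P → ¬ InducedIsMR S χ (minus S χ P)

  minus-intro : ∀ {P p} → p ≢ P → minus S χ P p ≡ true
  minus-intro {P} {p} p≢P with p ≟ P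
  ... | yes p≡P = contradiction p≡P p≢P
  ... | no _    = refl

  minus-elim : ∀ {P p} → minus S χ P p ≡ true → p ≢ P
  minus-elim {P} {p} p∈T with p ≟ P
  ... | no p≢P = p≢P

  ≢-of-opposite : ∀ {p q} → χ p ≡ opposite (χ q) → p ≢ q
  ≢-of-opposite χp refl = opposite-≢ (sym χp)

  line-unique : ∀ {p q l l′} → p ≢ q → p ∈ l → q ∈ l → p ∈ l′ → q ∈ l′ → l ≡ l′
  line-unique {p} {q} p≢q p∈l q∈l p∈l′ q∈l′ =
    let (_ , _ , _ , unique) = uniqueLine S p q p≢q
    in trans (unique _ p∈l q∈l) (sym (unique _ p∈l′ q∈l′))

  -- Joining P to the points of l is injective since two of them already span l.
  lineCard≤deg : ∀ {P l} → inc S P l ≡ false → lineCard S χ l ≤ deg S χ P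
  lineCard≤deg {P} {l} P∉l =
    count-≤-injection join (λ q q∈l → proj₁ (proj₂ (joinLine q q∈l))) inj
    where
    P≢ : ∀ {q} → q ∈ l → P ≢ q
    P≢ q∈l refl = not-¬ q∈l P∉l
    joinLine : ∀ q → q ∈ l → ∃[ j ] P ∈ j × q ∈ j
    joinLine q q∈l = let (j , P∈j , q∈j , _) = uniqueLine S P q (P≢ q∈l) in j , P∈j , q∈j
    join : ∀ q → q ∈ l → Fin m
    join q q∈l = proj₁ (joinLine q q∈l)
    inj : ∀ q q′ q∈l q′∈l → join q q∈l ≡ join q′ q′∈l → q ≡ q′
    inj q q′ q∈l q′∈l e = decidable-stable (q ≟ q′) λ q≢q′ →
      let (_ , P∈j , q∈j) = joinLine q q∈l
          q′∈j = subst (q′ ∈_) (sym e) (proj₂ (proj₂ (joinLine q′ q′∈l)))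
      in not-¬ (subst (P ∈_) (line-unique q≢q′ q∈j q′∈j q∈l q′∈l) P∈j) P∉l

  module MR (mr : IsMR S χ) where

    pointOfColour : ∀ l c → ∃[ p ] p ∈ l × χ p ≡ c
    pointOfColour l red   = proj₁ (mr l)
    pointOfColour l green = proj₂ (mr l)

    -- If all points but P lie on l, then P ∉ l; the line joining P to a point of l of P's
    -- colour carries a point of the other colour, also on l, so that line is l itself.
    minus-notCollinear : ∀ P → ¬ Collinear S χ (minus S χ P)
    minus-notCollinear P (l , others∈l) =
      let (q , q∈l , χq) = pointOfColour l (χ P)
          (L , P∈L , q∈L , _) = uniqueLine S P q λ P≡q → P∉l (subst (_∈ l) (sym P≡q) q∈l)
          (p , p∈L , χp) = pointOfColour L (opposite (χ P))
          p≢q = ≢-of-opposite (trans χp (cong opposite (sym χq)))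
          p∈l = others∈l p (minus-intro (≢-of-opposite χp))
      in P∉l (subst (P ∈_) (line-unique p≢q p∈L q∈L p∈l q∈l) P∈L)
      where
      P∉l : ¬ P ∈ l
      P∉l P∈l with notAllOnOneLine S l
      ... | p , p∉l with p ≟ P
      ...   | yes refl = not-¬ P∈l p∉l
      ...   | no p≢P   = not-¬ (others∈l p (minus-intro p≢P)) p∉l

    HasColourOff : Fin n → Colour → Fin m → Set
    HasColourOff P c l = ∃[ p ] lineMinus l P p ≡ true × χ p ≡ c

    hasColourOff? : ∀ P c l → Dec (HasColourOff P c l)
    hasColourOff? P c l = any? λ p → (lineMinus l P p Bool.≟ true) ×-dec (χ p ≟ᶜ c)

    hasOppositeOff : ∀ P l → HasColourOff P (opposite (χ P)) l
    hasOppositeOff P l =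
      let (p , p∈l , χp) = pointOfColour l (opposite (χ P))
      in p , ∧-intro p∈l (minus-intro (≢-of-opposite χp)) , χp

    inducedIsMR : ∀ P → (∀ l → 2 ≤ count (lineMinus l P) → HasColourOff P (χ P) l) →
      InducedIsMR S χ (minus S χ P)
    inducedIsMR P same = minus-notCollinear P , λ l two → every l two red , every l two green
      where
      every : ∀ l → 2 ≤ count (lineMinus l P) → ∀ c → HasColourOff P c l
      every l two c with colour-dichotomy (χ P) c
      ... | inj₁ refl = same l two
      ... | inj₂ refl = hasOppositeOff P l

    -- A line witnessing that S ∖ {P} is not MR: it keeps at least two points, none of P's colour.
    record IsolatingLine (P : Fin n) (l : Fin m) : Set where
      field
        through         : P ∈ l
        others-opposite : ∀ {p} → p ∈ l → p ≢ P → χ p ≡ opposite (χ P)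
        two-others      : 2 ≤ count (lineMinus l P)

      opposite-off : ∀ {p} → lineMinus l P p ≡ true → p ∈ l × χ p ≡ opposite (χ P)
      opposite-off h = let (p∈l , p∈T) = ∧-split h in p∈l , others-opposite p∈l (minus-elim p∈T)

    open IsolatingLine

    isolatingLine-of : ∀ {P l} → 2 ≤ count (lineMinus l P) →
      ¬ HasColourOff P (χ P) l → IsolatingLine P l
    isolatingLine-of {P} {l} two ¬same = record
      { through         = P∈l
      ; others-opposite = others-opposite′
      ; two-others      = two
      }
      where
      onlyP : ∀ {p} → p ∈ l → χ p ≡ χ P → p ≡ P
      onlyP {p} p∈l χp = decidable-stable (p ≟ P) λ p≢P →
        ¬same (p , ∧-intro p∈l (minus-intro p≢P) , χp)
      others-opposite′ : ∀ {p} → p ∈ l → p ≢ P → χ p ≡ opposite (χ P)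
      others-opposite′ {p} p∈l p≢P with colour-dichotomy (χ P) (χ p)
      ... | inj₁ χp≡χP = contradiction (onlyP p∈l χp≡χP) p≢P
      ... | inj₂ χp    = χp
      P∈l : P ∈ l
      P∈l = let (q , q∈l , χq) = pointOfColour l (χ P) in subst (_∈ l) (onlyP q∈l χq) q∈l

    isolatingLine : NoRemovablePoint → ∀ P → ∃ (IsolatingLine P)
    isolatingLine minimal P
      with any? (λ l → (2 ≤? count (lineMinus l P)) ×-dec ¬? (hasColourOff? P (χ P) l))
    ... | yes (l , two , ¬same) = l , isolatingLine-of two ¬same
    ... | no none = contradiction (inducedIsMR P λ l two →
                      decidable-stable (hasColourOff? P (χ P) l) λ ¬same → none (l , two , ¬same))
                    (minimal P)

    isolatingLine-colourCountOn-same : ∀ {P l} → IsolatingLine P l → colourCountOn (χ P) l ≡ 1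
    isolatingLine-colourCountOn-same {P} {l} iso =
      count≡1 (colourOn (χ P) l) (∧-intro (through iso) (isColour-intro {χ P} refl)) onlyP
      where
      onlyP : ∀ {p} → colourOn (χ P) l p ≡ true → p ≡ P
      onlyP {p} h = let (p∈l , χp) = ∧-split h in decidable-stable (p ≟ P) λ p≢P →
        opposite-≢ (trans (sym (others-opposite iso p∈l p≢P)) (isColour-elim χp))

    isolatingLine-colourCountOn-opposite : ∀ {P l} → IsolatingLine P l →
      2 ≤ colourCountOn (opposite (χ P)) l
    isolatingLine-colourCountOn-opposite {P} {l} iso = ≤-trans (two-others iso) (count-mono
      (lineMinus l P) (colourOn (opposite (χ P)) l) λ h →
      let (p∈l , χp) = opposite-off iso h in ∧-intro p∈l (isColour-intro χp))

    -- Choose on each line through P a point of the opposite colour, avoiding R₁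
    -- (on l₀ take R₂); distinct lines through P meet only in P, so this is injective.
    deg≤colourCount-opposite∸1 : ∀ {P l₀ R₁ R₂} → P ∈ l₀ → R₁ ≢ R₂ →
      R₁ ∈ l₀ → χ R₁ ≡ opposite (χ P) → R₂ ∈ l₀ → χ R₂ ≡ opposite (χ P) →
      deg S χ P ≤ colourCount (opposite (χ P)) ∸ 1
    deg≤colourCount-opposite∸1 {P} {l₀} {R₁} {R₂} P∈l₀ R₁≢R₂ R₁∈l₀ χR₁ R₂∈l₀ χR₂
      rewrite count-remove (hasColour (opposite (χ P))) (isColour-intro χR₁) =
      count-≤-injection (λ l P∈l → proj₁ (partner l P∈l)) into inj
      where
      partner : ∀ l → P ∈ l → ∃[ q ] q ∈ l × χ q ≡ opposite (χ P) × q ≢ R₁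
      partner l P∈l with l ≟ l₀
      ... | yes refl = R₂ , R₂∈l₀ , χR₂ , ≢-sym R₁≢R₂
      ... | no l≢l₀  =
        let (q , q∈l , χq) = pointOfColour l (opposite (χ P))
        in q , q∈l , χq , λ q≡R₁ →
             l≢l₀ (line-unique (≢-of-opposite χR₁) (subst (_∈ l) q≡R₁ q∈l) P∈l R₁∈l₀ P∈l₀)
      into : ∀ l P∈l → remove (hasColour (opposite (χ P))) R₁ (proj₁ (partner l P∈l)) ≡ true
      into l P∈l =
        let (_ , χq , q≢R₁) = proj₂ (partner l P∈l)
        in remove-intro (hasColour (opposite (χ P))) (isColour-intro χq) q≢R₁
      inj : ∀ l l′ P∈l P∈l′ → proj₁ (partner l P∈l) ≡ proj₁ (partner l′ P∈l′) → l ≡ l′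
      inj l l′ P∈l P∈l′ e =
        let (q∈l , χq , _) = proj₂ (partner l P∈l)
            q∈l′ = subst (_∈ l′) (sym e) (proj₁ (proj₂ (partner l′ P∈l′)))
        in line-unique (≢-of-opposite χq) q∈l P∈l q∈l′ P∈l′

    isolatingLine-deg : ∀ {P l} → IsolatingLine P l → deg S χ P ≤ colourCount (opposite (χ P)) ∸ 1
    isolatingLine-deg iso =
      let (R₁ , R₂ , R₁≢R₂ , R₁-off , R₂-off) = count-∃₂ (two-others iso)
          (R₁∈l , χR₁) = opposite-off iso R₁-off
          (R₂∈l , χR₂) = opposite-off iso R₂-off
      in deg≤colourCount-opposite∸1 (through iso) R₁≢R₂ R₁∈l χR₁ R₂∈l χR₂

    isolatingLine-counts : NoRemovablePoint → ∀ {c} P → χ P ≡ c →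
      ∃[ l ] P ∈ l × colourCountOn c l ≡ 1 × 2 ≤ colourCountOn (opposite c) l
    isolatingLine-counts minimal P refl =
      let (l , iso) = isolatingLine minimal P
      in l , through iso
           , isolatingLine-colourCountOn-same iso , isolatingLine-colourCountOn-opposite iso

    minimal-deg≤colourCount-opposite∸1 : NoRemovablePoint → ∀ {c} P → χ P ≡ c →
      deg S χ P ≤ colourCount (opposite c) ∸ 1
    minimal-deg≤colourCount-opposite∸1 minimal P refl =
      isolatingLine-deg (proj₂ (isolatingLine minimal P))

    colourCount<lineCard : ∀ c l → (∀ {p} → χ p ≡ c → p ∈ l) → colourCount c < lineCard S χ l
    colourCount<lineCard c l all∈l =
      let (q , q∈l , χq) = pointOfColour l (opposite c)
          q≢ : ∀ {p} → χ p ≡ c → p ≢ q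
          q≢ χp = ≢-sym (≢-of-opposite (trans χq (cong opposite (sym χp))))
          onl : Fin n → Bool
          onl p = inc S p l
      in subst (colourCount c <_) (sym (count-remove onl q∈l)) (s≤s
           (count-mono (hasColour c) (remove onl q) λ h →
              let χp = isColour-elim h in remove-intro onl (all∈l χp) (q≢ χp)))

    ¬allOfColourOnLine : DegreeBound → ∀ c l → ¬ (∀ {p} → χ p ≡ c → p ∈ l)
    ¬allOfColourOnLine degBound c l all∈l =
      let (p₀ , p₀∉l) = notAllOnOneLine S l
          χp₀ = opposite-of-≢ (λ χp₀≡c → not-¬ (all∈l χp₀≡c) p₀∉l)
      in <-irrefl refl (begin-strict
           colourCount c                       <⟨ colourCount<lineCard c l all∈l ⟩
           lineCard S χ l                      ≤⟨ lineCard≤deg p₀∉l ⟩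
           deg S χ p₀                          ≤⟨ degBound p₀ ⟩
           colourCount (opposite (χ p₀)) ∸ 1   ≤⟨ m∸n≤m _ 1 ⟩
           colourCount (opposite (χ p₀))       ≡⟨ cong colourCount χp₀ ⟩
           colourCount c                       ∎)
      where open ≤-Reasoning

    lineCard≤colourCount∸1 : DegreeBound → ∀ c l → lineCard S χ l ≤ colourCount c ∸ 1
    lineCard≤colourCount∸1 degBound c l
      with any? (λ P → (inc S P l Bool.≟ false) ×-dec (opposite (χ P) ≟ᶜ c))
    ... | yes (P , P∉l , χP) =
      ≤-trans (lineCard≤deg P∉l) (subst (λ d → deg S χ P ≤ colourCount d ∸ 1) χP (degBound P))
    ... | no none = contradiction
      (λ {p} χp → ¬-not λ p∉l → none (p , p∉l , trans (cong opposite χp) (opposite-involutive c)))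
      (¬allOfColourOnLine degBound (opposite c) l)

lemma3p2 : ∀ {n m : ℕ} (S : LinearSpace n m) (χ : Fin n → Colour) →
    IsMinimalMR S χ →
    ((∀ (G : Fin n) → χ G ≡ green →
        ∃[ l ] (inc S G l ≡ true × greensOn S χ l ≡ 1 × 2 ≤ redsOn S χ l))
     × (∀ (G : Fin n) → χ G ≡ green → deg S χ G ≤ r S χ ∸ 1)
     × (∀ (l : Fin m) → lineCard S χ l ≤ r S χ ∸ 1))
    ×
    ((∀ (R : Fin n) → χ R ≡ red →
        ∃[ l ] (inc S R l ≡ true × redsOn S χ l ≡ 1 × 2 ≤ greensOn S χ l))
     × (∀ (R : Fin n) → χ R ≡ red → deg S χ R ≤ g S χ ∸ 1)
     × (∀ (l : Fin m) → lineCard S χ l ≤ g S χ ∸ 1))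
lemma3p2 S χ (mr , minimal) =
    (isolatingLine-counts minimal , degree , lineCard≤colourCount∸1 degreeBound red)
  , (isolatingLine-counts minimal , degree , lineCard≤colourCount∸1 degreeBound green)
  where
  open Geometry S χ
  open MR mr
  degree : ∀ {c} P → χ P ≡ c → deg S χ P ≤ colourCount (opposite c) ∸ 1
  degree = minimal-deg≤colourCount-opposite∸1 minimal
  degreeBound : DegreeBound
  degreeBound P = degree P refl
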